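{- Let $G=(V,E)\in\mathcal{G}_{\mathcal{R}^{(1)},\mathcal{R}^{(2)}}$, let $U=\mathcal{R}^{(3)}(G)$, let $k$ be a positive integer and $\epsilon>0$, and let $\mathcal{C}$ be a $k$-clustering of $U$ of minimum total impurity. Let $c$ be the number of clusters of $\mathcal{C}$ consisting of a single edge, $d$ the number of clusters consisting of two edges without a common vertex, and $q$ the total number of edges in the clusters of the $e$-group. If the minimum vertex cover of $G$ has size at least $k(1+\epsilon)$, then $c+d+q\ge k\epsilon/2$.
   Context: All graphs are simple and undirected. Map $\mathcal{R}^{(1)}$: given a 4-regular graph $G'=(V',E')$ with $n$ vertices, choose $\hat E\subseteq E'$ with $|\hat E|=n$ such that $(V',\hat E)$ is bipartite; $\mathcal{R}^{(1)}(G')$ replaces each edge $(u,v)\in E'\setminus\hat E$ by a path $u,u',v',v$ with new vertices $u',v'$. Map $\mathcal{R}^{(2)}$: given $H$ of maximum degree at most 4, each degree-4 vertex $v$ with neighbours $w_1,\dots,w_4$ is replaced by a path $v_a,v_b,v_c$ of new vertices plus edges $(v_a,w_1),(v_a,w_2),(v_c,w_3),(v_c,w_4)$. $\mathcal{G}_{\mathcal{R}^{(1)},\mathcal{R}^{(2)}}$ is the set of graphs $\mathcal{R}^{(2)}(\mathcal{R}^{(1)}(G'))$, $G'$ 4-regular. For $G$ with vertices $v_1,\dots,v_n$, $U=\mathcal{R}^{(3)}(G)=\{v^e:e\in E\}\subseteq\mathbb{R}^n$, where $v^e$ for $e=(v_i,v_j)$ has 1 in coordinates $i,j$ and 0 elsewhere;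 vectors of $U$ are identified with edges of $G$. For $\mathbf{w}\in\mathbb{R}^n_{\ge0}$, $I_{Ent}(\mathbf{w})=\|\mathbf{w}\|_1\sum_i\frac{w_i}{\|\mathbf{w}\|_1}\log\frac{\|\mathbf{w}\|_1}{w_i}$ (base 2, zero terms omitted); for $C\subseteq U$, $I_{Ent}(C)=I_{Ent}(\sum_{\mathbf{v}\in C}\mathbf{v})$. A $k$-clustering is a partition of $U$ into $k$ nonempty clusters; its total impurity is the sum of the clusters' impurities. A cluster is a $p$-star if its $p$ edges all share a common vertex. The $e$-group of $\mathcal{C}$ consists of the clusters that are not a 3-star, not a 2-star, not a single edge, and not a pair of edges without common vertex.
   Formalization: The parameter ε ranges over the positive rationals. -}

module Defs where

open import Data.Bool using (Bool; true; false; T; _∧_; _∨_; not; if_then_else_)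
open import Data.Nat as ℕ using (ℕ; zero; suc; _+_; _*_; _^_; _≡ᵇ_)
open import Data.Fin as Fin using (Fin; _<?_)
open import Data.Fin.Patterns using (0F; 1F; 2F)
open import Data.List using (List; []; _∷_; _++_; length; lookup; allFin; concatMap)
open import Data.List.Membership.Propositional using (_∈_)
open import Data.Maybe using (Maybe; just; nothing)
open import Data.Product using (Σ; _×_; _,_; proj₁; proj₂; ∃)
open import Data.Sum using (_⊎_; inj₁; inj₂)
import Data.Sum.Properties as SumP
import Data.Product.Properties as ProdP
open import Data.Unit using (tt)
open import Relation.Binary.Definitions using (DecidableEquality)
open import Relation.Binary.PropositionalEquality using (_≡_; _≢_; refl)
open import Relation.Nullary using (Dec; yes; no; ⌊_⌋)
open import Relation.Nullary.Decidable using (T?)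
open import Data.Integer using (+_)
open import Data.Rational using (ℚ; _/_)

sumF : ∀ {n} → (Fin n → ℕ) → ℕ
sumF {zero}  f = 0
sumF {suc n} f = f Fin.zero + sumF (λ i → f (Fin.suc i))

prodF : ∀ {n} → (Fin n → ℕ) → ℕ
prodF {zero}  f = 1
prodF {suc n} f = f Fin.zero * prodF (λ i → f (Fin.suc i))

anyF : ∀ {n} → (Fin n → Bool) → Bool
anyF {zero}  f = false
anyF {suc n} f = f Fin.zero ∨ anyF (λ i → f (Fin.suc i))

allF : ∀ {n} → (Fin n → Bool) → Bool
allF {zero}  f = true
allF {suc n} f = f Fin.zero ∧ allF (λ i → f (Fin.suc i))

b2n : Bool → ℕ
b2n true  = 1
b2n false = 0

countF : ∀ {n} → (Fin n → Bool) → ℕ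
countF f = sumF (λ i → b2n (f i))

ℕtoℚ : ℕ → ℚ
ℕtoℚ n = (+ n) / 1

record Graph : Set₁ where
  field
    V     : Set
    _≟V_  : DecidableEquality V
    edges : List (V × V)

module _ (G : Graph) where
  open Graph G

  nE : ℕ
  nE = length edges

  edge : Fin nE → V × V
  edge = lookup edges

  -- coordinate x of the vector v^e ∈ U identified with edge e
  coord : V → V × V → ℕ
  coord x (a , b) = if ⌊ x ≟V a ⌋ ∨ ⌊ x ≟V b ⌋ then 1 else 0

  IsVertexCover : List V → Set
  IsVertexCover L = ∀ (i : Fin nE) → (proj₁ (edge i) ∈ L) ⊎ (proj₂ (edge i) ∈ L)

  module _ (k : ℕ) where
    IsKClustering : (Fin nE → Fin k) → Set
    IsKClustering f = ∀ (c : Fin k) → ∃ λ (i : Fin nE) → f i ≡ c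

    module _ (f : Fin nE → Fin k) (c : Fin k) where
      inC : Fin nE → Bool
      inC i = ⌊ f i Fin.≟ c ⌋

      size : ℕ
      size = countF inC

      weight : V → ℕ
      weight x = sumF (λ i → if inC i then coord x (edge i) else 0)

      -- ‖w‖₁ (every v^e has ℓ1-norm 2)
      norm1 : ℕ
      norm1 = sumF (λ i → if inC i then 2 else 0)

      -- I_Ent(c) = log₂ (impNum / impDen), where
      --   impNum = ‖w‖₁ ^ ‖w‖₁   and   impDen = ∏_{x, w_x > 0} w_x ^ w_x .
      -- Each vertex x with w_x > 0 is an endpoint of exactly w_x edges of
      -- the cluster, so impDen = ∏_{e ∈ c} w_{e₁} · w_{e₂}.
      impNum : ℕ
      impNum = norm1 ^ norm1

      impDen : ℕ
      impDen = prodF (λ i → if inC i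
                              then weight (proj₁ (edge i)) * weight (proj₂ (edge i))
                              else 1)

      commonVertex : Bool
      commonVertex =
        anyF (λ i → inC i ∧
          ( allF (λ j → not (inC j) ∨ (coord (proj₁ (edge i)) (edge j) ≡ᵇ 1))
          ∨ allF (λ j → not (inC j) ∨ (coord (proj₂ (edge i)) (edge j) ≡ᵇ 1))))

      isStar : ℕ → Bool
      isStar p = (size ≡ᵇ p) ∧ commonVertex

      isSingleEdge : Bool
      isSingleEdge = size ≡ᵇ 1

      isDisjointPair : Bool
      isDisjointPair = (size ≡ᵇ 2) ∧ not commonVertex

      inEGroup : Bool
      inEGroup = not (isStar 3) ∧ not (isStar 2) ∧ not isSingleEdge ∧ not isDisjointPair

    -- total impurity of f is log₂ (totNum f / totDen f)
    totNum : (Fin nE → Fin k) → ℕ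
    totNum f = prodF (λ c → impNum f c)

    totDen : (Fin nE → Fin k) → ℕ
    totDen f = prodF (λ c → impDen f c)

    -- total impurity of f ≤ total impurity of g
    -- ⇔ totNum f / totDen f ≤ totNum g / totDen g (log₂ monotone, dens > 0)
    _≤Imp_ : (Fin nE → Fin k) → (Fin nE → Fin k) → Set
    f ≤Imp g = totNum f * totDen g ℕ.≤ totNum g * totDen f

    IsOptimal : (Fin nE → Fin k) → Set
    IsOptimal f = IsKClustering f × (∀ g → IsKClustering g → f ≤Imp g)

    cCount : (Fin nE → Fin k) → ℕ
    cCount f = countF (λ c → isSingleEdge f c)

    dCount : (Fin nE → Fin k) → ℕ
    dCount f = countF (λ c → isDisjointPair f c)

    qCount : (Fin nE → Fin k) → ℕ
    qCount f = sumF (λ c → if inEGroup f c then size f c else 0)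

-- The input 4-regular graph G' on vertices Fin n (adjacency matrix adj),
-- the chosen edge set Ê (as a symmetric Boolean matrix), and the choice
-- made by R2: for every vertex v, side v u = true for the two neighbours
-- w₁,w₂ (attached to v_a) and false for w₃,w₄ (attached to v_c).

module _ {n : ℕ} (adj : Fin n → Fin n → Bool) where

  IsSimple : Set
  IsSimple = (∀ u v → adj u v ≡ adj v u) × (∀ v → adj v v ≡ false)

  Is4Regular : Set
  Is4Regular = IsSimple × (∀ v → countF (adj v) ≡ 4)

  IsValidHat : (Fin n → Fin n → Bool) → Set
  IsValidHat Ê =
      (∀ u v → Ê u v ≡ Ê v u)
    × (∀ u v → Ê u v ≡ true → adj u v ≡ true)
    × (sumF (λ u → countF (λ v → ⌊ u <? v ⌋ ∧ Ê u v)) ≡ n)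
    × (∃ λ (col : Fin n → Bool) → ∀ u v → Ê u v ≡ true → col u ≢ col v)

  IsValidSplit : (Fin n → Fin n → Bool) → Set
  IsValidSplit side = ∀ v → countF (λ u → adj v u ∧ side v u) ≡ 2

  module _ (Ê side : Fin n → Fin n → Bool) where
    -- new vertex p(v,u) of R1 for an edge (v,u) ∉ Ê : the path v, p(v,u), p(u,v), u
    PV : Set
    PV = Σ (Fin n × Fin n) (λ p → T (adj (proj₁ p) (proj₂ p) ∧ not (Ê (proj₁ p) (proj₂ p))))

    -- vertices of R2(R1(G')): (v , 0/1/2) = v_a / v_b / v_c, and the p(v,u)
    Vtx : Set
    Vtx = (Fin n × Fin 3) ⊎ PV

    private
      T-dec : ∀ {b} → DecidableEquality (T b)
      T-dec {true} tt tt = yes refl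

    _≟Vtx_ : DecidableEquality Vtx
    _≟Vtx_ = SumP.≡-dec (ProdP.≡-dec Fin._≟_ Fin._≟_)
                        (ProdP.≡-dec (ProdP.≡-dec Fin._≟_ Fin._≟_) T-dec)

    va vb vc : Fin n → Vtx
    va v = inj₁ (v , 0F)
    vb v = inj₁ (v , 1F)
    vc v = inj₁ (v , 2F)

    -- the vertex replacing v in the R1-edge from v towards its G'-neighbour u
    att : Fin n → Fin n → Vtx
    att v u = if side v u then va v else vc v

    pv : Fin n → Fin n → Maybe PV
    pv v u with T? (adj v u ∧ not (Ê v u))
    ... | yes p = just ((v , u) , p)
    ... | no _  = nothing

    pathEdges : Fin n → List (Vtx × Vtx)
    pathEdges v = (va v , vb v) ∷ (vb v , vc v) ∷ []

    hatEdge : Fin n → Fin n → List (Vtx × Vtx)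
    hatEdge v u = if ⌊ v <? u ⌋ ∧ Ê v u then (att v u , att u v) ∷ [] else []

    attachEdge : Fin n → Fin n → List (Vtx × Vtx)
    attachEdge v u with pv v u
    ... | just p  = (att v u , inj₂ p) ∷ []
    ... | nothing = []

    midEdge : Fin n → Fin n → List (Vtx × Vtx)
    midEdge v u with ⌊ v <? u ⌋ | pv v u | pv u v
    ... | true | just p | just q = (inj₂ p , inj₂ q) ∷ []
    ... | _    | _      | _      = []

    R21 : Graph
    R21 = record
      { V     = Vtx
      ; _≟V_  = _≟Vtx_
      ; edges = concatMap pathEdges (allFin n)
             ++ concatMap (λ v → concatMap (λ u → hatEdge v u ++ attachEdge v u ++ midEdge v u)
                                           (allFin n))
                          (allFin n)
      }

{-# OPTIONS --safe #-}
-- Cover every cluster separately.  A cluster whose edges share a vertex is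
-- covered by that vertex; any other cluster by one endpoint of each of its
-- edges.  A cluster of the second kind with one or two edges is a single edge
-- or a disjoint pair, and otherwise it lies in the e-group, so the union of
-- these covers is a vertex cover with at most k + c + d + q vertices.  Hence
-- k (1 + ε) ≤ k + c + d + q, i.e. c + d + q ≥ k ε ≥ k ε / 2.
module Submission where

open import Defs
open import Data.Bool using (Bool)
open import Data.Nat using (ℕ; _+_; _≤_)
open import Data.Fin using (Fin)
open import Data.List using (List; length)
open import Data.Rational using (ℚ; _*_; _<_; 0ℚ; 1ℚ; ½)
import Data.Rational as ℚ

open import Data.Bool using (true; false; T; not; _∨_; if_then_else_)
open import Data.Bool.Properties using (T-≡; T-∧; T-∨)
import Data.Fin as Fin
import Data.Integer as ℤ
import Data.Integer.Properties as ℤ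
open import Data.List using ([]; [_]; concat; tabulate)
open import Data.List.Properties using (length-++)
open import Data.List.Membership.Propositional using (_∈_)
open import Data.List.Membership.Propositional.Properties using (∈-concat⁺′; ∈-tabulate⁺)
open import Data.List.Relation.Unary.Any using (here)
open import Data.Nat as ℕ using (zero; suc; s≤s; z≤n; _≡ᵇ_)
import Data.Nat.Properties as ℕ
open import Data.Nat.Coprimality using (1-coprimeTo)
import Data.Nat.Coprimality as Coprime
open import Data.Product using (Σ; ∃; _×_; _,_; proj₁; proj₂)
open import Data.Rational using (mkℚ; toℚᵘ; -_; NonNegative)
import Data.Rational.Properties as ℚ
import Data.Rational.Unnormalised as ℚᵘ
import Data.Rational.Unnormalised.Properties as ℚᵘ
open import Algebra.Properties.CommutativeSemigroup ℕ.+-commutativeSemigroup using (interchange)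
open import Algebra.Properties.Group ℚ.+-0-group using (\\-leftDividesʳ)
open import Data.Sum using (_⊎_; inj₁; inj₂)
import Data.Sum as Sum
open import Function using (Equivalence; _∘_)
open import Relation.Nullary using (yes; no)
open import Relation.Nullary.Decidable using (fromWitness)
open import Relation.Binary.PropositionalEquality
  using (_≡_; refl; sym; trans; cong; cong₂; module ≡-Reasoning)

open Equivalence using (to; from)

sumF-cong : ∀ {m} {g h : Fin m → ℕ} → (∀ i → g i ≡ h i) → sumF g ≡ sumF h
sumF-cong {zero}  g≡h = refl
sumF-cong {suc m} g≡h = cong₂ _+_ (g≡h Fin.zero) (sumF-cong (g≡h ∘ Fin.suc))

sumF-mono-≤ : ∀ {m} {g h : Fin m → ℕ} → (∀ i → g i ≤ h i) → sumF g ≤ sumF h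
sumF-mono-≤ {zero}  g≤h = z≤n
sumF-mono-≤ {suc m} g≤h = ℕ.+-mono-≤ (g≤h Fin.zero) (sumF-mono-≤ (g≤h ∘ Fin.suc))

sumF-+ : ∀ {m} (g h : Fin m → ℕ) → sumF (λ i → g i + h i) ≡ sumF g + sumF h
sumF-+ {zero}  g h = refl
sumF-+ {suc m} g h =
  trans (cong ((g Fin.zero + h Fin.zero) +_) (sumF-+ (g ∘ Fin.suc) (h ∘ Fin.suc)))
        (interchange (g Fin.zero) (h Fin.zero) (sumF (g ∘ Fin.suc)) (sumF (h ∘ Fin.suc)))

sumF-const : ∀ m c → sumF {m} (λ _ → c) ≡ m ℕ.* c
sumF-const zero    c = refl
sumF-const (suc m) c = cong (c +_) (sumF-const m c)

anyF⇒∃ : ∀ {m} (g : Fin m → Bool) → T (anyF g) → ∃ λ i → T (g i)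
anyF⇒∃ {suc m} g any with g Fin.zero in g0
... | true  = Fin.zero , from T-≡ g0
... | false = let i , gi = anyF⇒∃ (g ∘ Fin.suc) any in Fin.suc i , gi

allF⇒∀ : ∀ {m} (g : Fin m → Bool) → T (allF g) → ∀ i → T (g i)
allF⇒∀ {suc m} g all i with g Fin.zero in g0
allF⇒∀ {suc m} g all Fin.zero    | true = from T-≡ g0
allF⇒∀ {suc m} g all (Fin.suc i) | true = allF⇒∀ (g ∘ Fin.suc) all i

T-not∨-elim : ∀ {a b} → T (not a ∨ b) → T a → T b
T-not∨-elim {true} b _ = b

length-concat-tabulate : ∀ {m} {A : Set} (g : Fin m → List A) →
                         length (concat (tabulate g)) ≡ sumF (length ∘ g)
length-concat-tabulate {zero}  g = refl
length-concat-tabulate {suc m} g =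
  trans (length-++ (g Fin.zero)) (cong (length (g Fin.zero) +_) (length-concat-tabulate (g ∘ Fin.suc)))

module _ (G : Graph) where
  open Graph G

  coord≡1⇒endpoint : ∀ x e → T (coord G x e ≡ᵇ 1) → x ≡ proj₁ e ⊎ x ≡ proj₂ e
  coord≡1⇒endpoint x (a , b) _  with x ≟V a | x ≟V b
  ... | yes x≡a | _       = inj₁ x≡a
  ... | no _    | yes x≡b = inj₂ x≡b

  module _ (k : ℕ) (f : Fin (nE G) → Fin k) where

    CoversCluster : List V → Fin k → Set
    CoversCluster L c = ∀ i → f i ≡ c → proj₁ (edge G i) ∈ L ⊎ proj₂ (edge G i) ∈ L

    incident⇒covers : ∀ c x → T (allF λ j → not (inC G k f c j) ∨ (coord G x (edge G j) ≡ᵇ 1)) →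
                      CoversCluster [ x ] c
    incident⇒covers c x incident i fi≡c =
      Sum.map (here ∘ sym) (here ∘ sym)
        (coord≡1⇒endpoint x (edge G i) (T-not∨-elim (allF⇒∀ _ incident i) (fromWitness fi≡c)))

    commonVertex⇒centre : ∀ c → T (commonVertex G k f c) → ∃ λ x → CoversCluster [ x ] c
    commonVertex⇒centre c common
      with i , inCi∧shared ← anyF⇒∃ _ common
      with to T-∨ (proj₂ (to T-∧ inCi∧shared))
    ... | inj₁ shared = proj₁ (edge G i) , incident⇒covers c _ shared
    ... | inj₂ shared = proj₂ (edge G i) , incident⇒covers c _ shared

    firstEndpointIfIn : Fin k → Fin (nE G) → List V
    firstEndpointIfIn c i = if inC G k f c i then [ proj₁ (edge G i) ] else []

    firstEndpoints : Fin k → List V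
    firstEndpoints c = concat (tabulate (firstEndpointIfIn c))

    firstEndpoints-covers : ∀ c → CoversCluster (firstEndpoints c) c
    firstEndpoints-covers c i fi≡c = inj₁ (∈-concat⁺′ (selected (fromWitness fi≡c)) (∈-tabulate⁺ i))
      where
      selected : ∀ {b} → T b → proj₁ (edge G i) ∈ (if b then [ proj₁ (edge G i) ] else [])
      selected {true} _ = here refl

    length-firstEndpoints : ∀ c → length (firstEndpoints c) ≡ size G k f c
    length-firstEndpoints c =
      trans (length-concat-tabulate (firstEndpointIfIn c)) (sumF-cong λ i → length-singletonIf (inC G k f c i))
      where
      length-singletonIf : ∀ b {x : V} → length (if b then [ x ] else []) ≡ b2n b
      length-singletonIf true  = refl
      length-singletonIf false = refl

    budget : Fin k → ℕ
    budget c = 1 + (b2n (isSingleEdge G k f c) + b2n (isDisjointPair G k f c)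
                    + (if inEGroup G k f c then size G k f c else 0))

    -- Without a common vertex, a cluster of size 1 or 2 is a single edge or a
    -- disjoint pair, and a cluster of any other size is in the e-group.
    size≤budget : ∀ c → commonVertex G k f c ≡ false → size G k f c ≤ budget c
    size≤budget c noCommon rewrite noCommon with size G k f c
    ... | 0                           = z≤n
    ... | 1                           = s≤s z≤n
    ... | 2                           = s≤s (s≤s z≤n)
    ... | 3                           = ℕ.m≤n+m 3 1
    ... | suc (suc (suc (suc s)))     = ℕ.m≤n+m _ 1

    clusterCover : ∀ c → Σ (List V) λ L → CoversCluster L c × length L ≤ budget c
    clusterCover c = byCommonVertex (commonVertex G k f c) refl
      where
      byCommonVertex : ∀ b → commonVertex G k f c ≡ b → Σ (List V) λ L → CoversCluster L c × length L ≤ budget c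
      byCommonVertex true common =
        let x , covers = commonVertex⇒centre c (from T-≡ common) in [ x ] , covers , s≤s z≤n
      byCommonVertex false noCommon =
        firstEndpoints c , firstEndpoints-covers c ,
        ℕ.≤-trans (ℕ.≤-reflexive (length-firstEndpoints c)) (size≤budget c noCommon)

    sumF-budget : sumF budget ≡ k + (cCount G k f + dCount G k f + qCount G k f)
    sumF-budget = begin
      sumF budget                                  ≡⟨ sumF-+ (λ _ → 1) extra ⟩
      sumF {k} (λ _ → 1) + sumF extra              ≡⟨ cong₂ _+_ (trans (sumF-const k 1) (ℕ.*-identityʳ k)) sumF-extra ⟩
      k + (cCount G k f + dCount G k f + qCount G k f) ∎
      where
      open ≡-Reasoning
      single pair : Fin k → ℕ
      single c = b2n (isSingleEdge G k f c)
      pair   c = b2n (isDisjointPair G k f c)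
      eGroupSize : Fin k → ℕ
      eGroupSize c = if inEGroup G k f c then size G k f c else 0
      extra : Fin k → ℕ
      extra c = single c + pair c + eGroupSize c
      sumF-extra : sumF extra ≡ cCount G k f + dCount G k f + qCount G k f
      sumF-extra = trans (sumF-+ (λ c → single c + pair c) eGroupSize) (cong (_+ qCount G k f) (sumF-+ single pair))

    clusteringCover : List V
    clusteringCover = concat (tabulate (proj₁ ∘ clusterCover))

    clusteringCover-isVertexCover : IsVertexCover G clusteringCover
    clusteringCover-isVertexCover i =
      Sum.map inClusteringCover inClusteringCover (proj₁ (proj₂ (clusterCover (f i))) i refl)
      where
      inClusteringCover : ∀ {x} → x ∈ proj₁ (clusterCover (f i)) → x ∈ clusteringCover
      inClusteringCover x∈ = ∈-concat⁺′ x∈ (∈-tabulate⁺ (f i))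

    length-clusteringCover : length clusteringCover ≤ k + (cCount G k f + dCount G k f + qCount G k f)
    length-clusteringCover = begin
      length clusteringCover                  ≡⟨ length-concat-tabulate (proj₁ ∘ clusterCover) ⟩
      sumF (length ∘ proj₁ ∘ clusterCover)    ≤⟨ sumF-mono-≤ (proj₂ ∘ proj₂ ∘ clusterCover) ⟩
      sumF budget                             ≡⟨ sumF-budget ⟩
      k + (cCount G k f + dCount G k f + qCount G k f) ∎
      where open ℕ.≤-Reasoning

ℕtoℚ≡mkℚ : ∀ n → ℕtoℚ n ≡ mkℚ (ℤ.+ n) 0 (Coprime.sym (1-coprimeTo n))
ℕtoℚ≡mkℚ n = ℚ.normalize-coprime (Coprime.sym (1-coprimeTo n))

ℕtoℚ-mono-≤ : ∀ {m n} → m ≤ n → ℕtoℚ m ℚ.≤ ℕtoℚ n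
ℕtoℚ-mono-≤ {m} {n} m≤n rewrite ℕtoℚ≡mkℚ m | ℕtoℚ≡mkℚ n =
  ℚ.*≤* (ℤ.*-monoʳ-≤-nonNeg (ℤ.+ 1) (ℤ.+≤+ m≤n))

ℕtoℚ-+ : ∀ m n → ℕtoℚ (m + n) ≡ ℕtoℚ m ℚ.+ ℕtoℚ n
ℕtoℚ-+ m n = ℚ.toℚᵘ-injective (ℚᵘ.≃-trans unnormalised (ℚᵘ.≃-sym (ℚ.toℚᵘ-homo-+ (ℕtoℚ m) (ℕtoℚ n))))
  where
  unnormalised : toℚᵘ (ℕtoℚ (m + n)) ℚᵘ.≃ toℚᵘ (ℕtoℚ m) ℚᵘ.+ toℚᵘ (ℕtoℚ n)
  unnormalised rewrite ℕtoℚ≡mkℚ m | ℕtoℚ≡mkℚ n | ℕtoℚ≡mkℚ (m + n) =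
    ℚᵘ.*≡* (cong (ℤ._* ℤ.+ 1)
      (trans (ℤ.pos-+ m n) (sym (cong₂ ℤ._+_ (ℤ.*-identityʳ (ℤ.+ m)) (ℤ.*-identityʳ (ℤ.+ n))))))

+-cancelˡ-≤ : ∀ r {p q} → r ℚ.+ p ℚ.≤ r ℚ.+ q → p ℚ.≤ q
+-cancelˡ-≤ r {p} {q} r+p≤r+q = begin
  p                   ≡⟨ sym (\\-leftDividesʳ r p) ⟩
  - r ℚ.+ (r ℚ.+ p)   ≤⟨ ℚ.+-monoʳ-≤ (- r) r+p≤r+q ⟩
  - r ℚ.+ (r ℚ.+ q)   ≡⟨ \\-leftDividesʳ r q ⟩
  q                   ∎
  where open ℚ.≤-Reasoning

*½-≤ : ∀ p → .{{NonNegative p}} → p * ½ ℚ.≤ p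
*½-≤ p = begin
  p * ½    ≤⟨ ℚ.*-monoˡ-≤-nonNeg p (ℚ.*≤* (ℤ.+≤+ (s≤s z≤n))) ⟩
  p * 1ℚ   ≡⟨ ℚ.*-identityʳ p ⟩
  p        ∎
  where open ℚ.≤-Reasoning

k*[1+ε]≤k+m⇒k*ε*½≤m : ∀ k m ε → 0ℚ < ε → ℕtoℚ k * (1ℚ ℚ.+ ε) ℚ.≤ ℕtoℚ (k + m) → ℕtoℚ k * ε * ½ ℚ.≤ ℕtoℚ m
k*[1+ε]≤k+m⇒k*ε*½≤m k m ε ε>0 k[1+ε]≤k+m = ℚ.≤-trans (*½-≤ (K * ε)) (+-cancelˡ-≤ K (begin
  K ℚ.+ K * ε         ≡⟨ cong (ℚ._+ K * ε) (sym (ℚ.*-identityʳ K)) ⟩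
  K * 1ℚ ℚ.+ K * ε    ≡⟨ sym (ℚ.*-distribˡ-+ K 1ℚ ε) ⟩
  K * (1ℚ ℚ.+ ε)      ≤⟨ k[1+ε]≤k+m ⟩
  ℕtoℚ (k + m)        ≡⟨ ℕtoℚ-+ k m ⟩
  K ℚ.+ ℕtoℚ m        ∎))
  where
  open ℚ.≤-Reasoning
  K : ℚ
  K = ℕtoℚ k
  instance
    _ : NonNegative (K * ε)
    _ = ℚ.nonNeg*nonNeg⇒nonNeg K {{ℚ.normalize-nonNeg k 1}} ε {{ℚ.pos⇒nonNeg ε {{ℚ.positive ε>0}}}}

proposition4 :
    (n : ℕ) (adj Ê side : Fin n → Fin n → Bool) →
    Is4Regular adj → IsValidHat adj Ê → IsValidSplit adj side →
    (k : ℕ) → 1 ≤ k → (ε : ℚ) → 0ℚ < ε →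
    (f : Fin (nE (R21 adj Ê side)) → Fin k) → IsOptimal (R21 adj Ê side) k f →
    (∀ (L : List (Graph.V (R21 adj Ê side))) → IsVertexCover (R21 adj Ê side) L →
      ℕtoℚ k * (1ℚ ℚ.+ ε) ℚ.≤ ℕtoℚ (length L)) →
    ℕtoℚ k * ε * ½ ℚ.≤
      ℕtoℚ (cCount (R21 adj Ê side) k f + dCount (R21 adj Ê side) k f + qCount (R21 adj Ê side) k f)
proposition4 n adj Ê side _ _ _ k _ ε ε>0 f _ coverBound =
  k*[1+ε]≤k+m⇒k*ε*½≤m k _ ε ε>0
    (ℚ.≤-trans (coverBound (clusteringCover G k f) (clusteringCover-isVertexCover G k f))
               (ℕtoℚ-mono-≤ (length-clusteringCover G k f)))
  where
  G : Graph
  G = R21 adj Ê side
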